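{- Let $G$ be an $(m,s)$-query graph and $S\subseteq[m]$. If $\mathrm{girth}(G)>4|S|$, then $\mathcal{T}_G$ is satisfiable for $S$.
   Context: An $(m,s)$-query graph is a graph $G$ with three disjoint vertex sets $A=\{A[1],\dots,A[s]\}$, $A_0=\{A_0[1],\dots,A_0[s]\}$, $A_1=\{A_1[1],\dots,A_1[s]\}$, in which every vertex of $A$ has even degree; with each $x\in[m]$ is associated a triple $(i(x),i_0(x),i_1(x))\in[s]^3$ such that $\{A[i(x)],A_0[i_0(x)]\}$ and $\{A[i(x)],A_1[i_1(x)]\}$ are edges of $G$, both labelled $x$, and no edge receives more than one label. The query scheme $\mathcal{T}_G$ uses three arrays $A,A_0,A_1$ of $s$ bits each and answers the query ``Is $x\in S$?'' as follows: read $A[i(x)]$; if it is $1$, answer Yes iff $A_1[i_1(x)]=1$; otherwise answer Yes iff $A_0[i_0(x)]=1$. $\mathcal{T}_G$ is satisfiable for $S$ if some assignment of bits to the three arrays makes all queries ``Is $x\in S$?'', $x\in[m]$, answered correctly. The girth of $G$ is the length of its shortest cycle. -}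

module Defs where

open import Data.Nat using (ℕ; zero; suc; _+_; _≤_)
open import Data.Nat.Divisibility using (_∣_)
open import Data.Bool using (Bool; true; false; if_then_else_)
open import Data.Fin using (Fin; zero; suc; fromℕ; inject₁)
open import Data.Fin.Subset using (Subset)
open import Data.List using (List; map; _++_; allFin)
open import Data.Nat.ListAction using (sum)
open import Data.Vec using (lookup)
open import Data.Product using (_×_; _,_; Σ; ∃)
open import Relation.Binary.PropositionalEquality using (_≡_; _≢_)
open import Relation.Nullary using (¬_)

data Vtx (s : ℕ) : Set where
  vA  : Fin s → Vtx s
  vA₀ : Fin s → Vtx s
  vA₁ : Fin s → Vtx s

allVtx : (s : ℕ) → List (Vtx s)
allVtx s = map vA (allFin s) ++ map vA₀ (allFin s) ++ map vA₁ (allFin s)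

record Graph (s : ℕ) : Set where
  field
    adj     : Vtx s → Vtx s → Bool
    adj-sym : ∀ u v → adj u v ≡ adj v u
    adj-irr : ∀ v → adj v v ≡ false

degree : ∀ {s} → Graph s → Vtx s → ℕ
degree {s} G v = sum (map (λ w → if Graph.adj G v w then 1 else 0) (allVtx s))

-- A cycle of length suc n (n+1 ≥ 3 required separately): pairwise distinct
-- vertices f 0, …, f n with f i ~ f (i+1) and f n ~ f 0.
IsCycle : ∀ {s} → Graph s → (n : ℕ) → (Fin (suc n) → Vtx s) → Set
IsCycle G n f =
  (∀ i j → f i ≡ f j → i ≡ j) ×
  (∀ (i : Fin n) → Graph.adj G (f (inject₁ i)) (f (suc i)) ≡ true) ×
  (Graph.adj G (f (fromℕ n)) (f zero) ≡ true)

GirthGreaterThan : ∀ {s} → Graph s → ℕ → Set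
GirthGreaterThan G L =
  ∀ n → 3 ≤ suc n → suc n ≤ L → ∀ f → ¬ IsCycle G n f

record QueryGraph (m s : ℕ) : Set where
  field
    graph   : Graph s
    evenDeg : ∀ (j : Fin s) → 2 ∣ degree graph (vA j)
    i i₀ i₁ : Fin m → Fin s
    edge₀   : ∀ x → Graph.adj graph (vA (i x)) (vA₀ (i₀ x)) ≡ true
    edge₁   : ∀ x → Graph.adj graph (vA (i x)) (vA₁ (i₁ x)) ≡ true
    -- no edge receives more than one label (edges A–A₀ and A–A₁ never coincide)
    label₀-inj : ∀ x y → x ≢ y → (i x , i₀ x) ≢ (i y , i₀ y)
    label₁-inj : ∀ x y → x ≢ y → (i x , i₁ x) ≢ (i y , i₁ y)

-- Answer of the query scheme T_G to "Is x ∈ S?" under bit arrays a, a₀, a₁.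
answer : ∀ {m s} → QueryGraph m s → (Fin s → Bool) → (Fin s → Bool) → (Fin s → Bool) → Fin m → Bool
answer Q a a₀ a₁ x =
  if a (QueryGraph.i Q x) then a₁ (QueryGraph.i₁ Q x) else a₀ (QueryGraph.i₀ Q x)

Satisfiable : ∀ {m s} → QueryGraph m s → Subset m → Set
Satisfiable {m} {s} Q S =
  Σ (Fin s → Bool) λ a → Σ (Fin s → Bool) λ a₀ → Σ (Fin s → Bool) λ a₁ →
    ∀ (x : Fin m) → answer Q a a₀ a₁ x ≡ lookup S x

-- Given the A-bits b, set A_c[p] = 1 exactly when p = i_c(x) for some x ∈ S with b(i(x)) = c.
-- Every query is then answered correctly unless some x ∈ S and y ∉ S share the cell A_c[p] while
-- b(i(x)) = b(i(y)) = c: a c-conflict between A[i(x)] and A[i(y)]. A conflict-free b is built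
-- greedily: give some vertex u a colour c such that u has no c-conflict with a vertex not yet
-- coloured, and recurse. If this gets stuck, every uncoloured vertex has conflicts of both colours,
-- so conflicts of alternating colours can be followed forever. A conflict is a path
-- A[u] – A_c[i_c(x)] – A[w] with x ∈ S and u ≠ w, so this is a non-backtracking walk in G whose
-- middle vertices are determined by the pair (c, x). Among 2|S| + 1 consecutive conflicts two
-- middle vertices coincide, closing a walk of length at most 4|S|, hence a cycle of length at
-- most 4|S|.

module Submission where

open import Defs
open import Data.Nat using (ℕ; _*_)
open import Data.Fin.Subset using (Subset; ∣_∣)

open import Data.Nat using (zero; suc; _+_; _∸_; _≤_; _<_; z≤n; s≤s)
open import Data.Nat.Properties
  using (≤-refl; ≤-trans; ≤-reflexive; <⇒≤; m≤n+m; m∸n≤m; m+n∸m≡n; +-suc; +-assoc;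
         +-comm; +-identityʳ; +-mono-≤; +-mono-<; n<1+n; m≤n⇒∃[o]m+o≡n)
open import Data.Nat.Induction using (<-rec)
open import Data.Nat.Tactic.RingSolver using (solve-∀)
open import Data.Bool using (Bool; true; false; not)
open import Data.Fin as Fin using (Fin; zero; suc; toℕ; fromℕ; inject₁; join; splitAt; _≟_; _<?_)
open import Data.Fin.Properties
  using (any?; <-cmp; pigeonhole; suc-injective; toℕ-inject₁; toℕ-fromℕ; toℕ≤pred[n]; splitAt-join)
open import Data.Fin.Subset using (_∈_; _∉_; _⊂_; _-_; ⊤)
open import Data.Fin.Subset.Properties using (_∈?_; ∈⊤; nonempty?; x∈p⇒p-x⊂p; x∈p∧x≢y⇒x∈p-y)
open import Data.Fin.Subset.Induction using (Acc; acc; ⊂-wellFounded)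
open import Data.Vec using (_∷_; here; there; lookup)
open import Data.Vec.Properties using (lookup⇒[]=; []=⇒lookup)
open import Data.Vec.Functional using (updateAt)
open import Data.Vec.Functional.Properties using (updateAt-updates; updateAt-minimal)
open import Data.Product using (∃; ∃₂; _×_; _,_; proj₁; proj₂)
open import Data.Sum using (_⊎_; inj₁; inj₂; swap)
open import Data.Empty using (⊥-elim)
open import Function using (_∘_; const; flip)
open import Relation.Nullary using (¬_; Dec; yes; no; does; contradiction)
open import Relation.Nullary.Decidable using (_×-dec_; _⊎-dec_; ¬?; map′; decidable-stable)
open import Relation.Binary using (DecidableEquality; tri<; tri≈; tri>)
open import Relation.Binary.PropositionalEquality
  using (_≡_; _≢_; refl; sym; trans; cong; cong₂; subst; ≢-sym; module ≡-Reasoning)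
import Data.Bool.Properties as Bool

interleave : ∀ {A : Set} → (ℕ → A) → (ℕ → A) → ℕ → A
interleave f g zero    = f zero
interleave f g (suc n) = interleave g (f ∘ suc) n

interleave-even : ∀ {A : Set} (f g : ℕ → A) k → interleave f g (k + k) ≡ f k
interleave-even f g zero    = refl
interleave-even f g (suc k) rewrite +-suc k k = interleave-even (f ∘ suc) (g ∘ suc) k

interleave-step : ∀ {A : Set} (R : A → A → Set) {f g : ℕ → A} →
  (∀ k → R (f k) (g k)) → (∀ k → R (g k) (f (suc k))) →
  ∀ n → R (interleave f g n) (interleave f g (suc n))
interleave-step R fg gf zero    = fg zero
interleave-step R fg gf (suc n) = interleave-step R gf (fg ∘ suc) n

interleave-step₂ : ∀ {A : Set} (R : A → A → Set) {f g : ℕ → A} →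
  (∀ k → R (f k) (f (suc k))) → (∀ k → R (g k) (g (suc k))) →
  ∀ n → R (interleave f g n) (interleave f g (suc (suc n)))
interleave-step₂ R ff gg zero    = ff zero
interleave-step₂ R ff gg (suc n) = interleave-step₂ R gg (ff ∘ suc) n

collision-or-injective : ∀ {A : Set} {n} → DecidableEquality A → (f : Fin n → A) →
  (∃₂ λ i j → i Fin.< j × f i ≡ f j) ⊎ (∀ i j → f i ≡ f j → i ≡ j)
collision-or-injective eq? f with any? (λ i → any? λ j → (i <? j) ×-dec eq? (f i) (f j))
... | yes collision = inj₁ collision
... | no none       = inj₂ injective
  where
  injective : ∀ i j → f i ≡ f j → i ≡ j
  injective i j fi≡fj with <-cmp i j
  ... | tri< i<j _ _ = ⊥-elim (none (i , j , i<j , fi≡fj))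
  ... | tri≈ _ i≡j _ = i≡j
  ... | tri> _ _ j<i = ⊥-elim (none (j , i , j<i , sym fi≡fj))

vA-injective : ∀ {s} {a b : Fin s} → vA a ≡ vA b → a ≡ b
vA-injective refl = refl

_≟ᵛ_ : ∀ {s} → DecidableEquality (Vtx s)
vA  a ≟ᵛ vA  b = map′ (cong vA)  vA-injective       (a ≟ b)
vA₀ a ≟ᵛ vA₀ b = map′ (cong vA₀) (λ { refl → refl }) (a ≟ b)
vA₁ a ≟ᵛ vA₁ b = map′ (cong vA₁) (λ { refl → refl }) (a ≟ b)
vA  _ ≟ᵛ vA₀ _ = no λ ()
vA  _ ≟ᵛ vA₁ _ = no λ ()
vA₀ _ ≟ᵛ vA  _ = no λ ()
vA₀ _ ≟ᵛ vA₁ _ = no λ ()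
vA₁ _ ≟ᵛ vA  _ = no λ ()
vA₁ _ ≟ᵛ vA₀ _ = no λ ()

module _ {s} (G : Graph s) where
  open Graph G

  adj⇒≢ : ∀ {u v} → adj u v ≡ true → u ≢ v
  adj⇒≢ {u} uv refl = contradiction (trans (sym uv) (adj-irr u)) λ ()

  CycleWithin : ℕ → Set
  CycleWithin L = ∃₂ λ n (f : Fin (suc n) → Vtx s) → 3 ≤ suc n × suc n ≤ L × IsCycle G n f

  girth⇒¬CycleWithin : ∀ {L} → GirthGreaterThan G L → ¬ CycleWithin L
  girth⇒¬CycleWithin girth (n , f , 3≤n , n≤L , cycle) = girth n 3≤n n≤L f cycle

  CycleWithin-mono : ∀ {L L′} → L ≤ L′ → CycleWithin L → CycleWithin L′
  CycleWithin-mono L≤L′ (n , f , 3≤n , n≤L , cycle) = n , f , 3≤n , ≤-trans n≤L L≤L′ , cycle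

  record NonBacktrackingWalk : Set where
    field
      vertex          : ℕ → Vtx s
      adjacent        : ∀ n → adj (vertex n) (vertex (suc n)) ≡ true
      nonBacktracking : ∀ n → vertex n ≢ vertex (suc (suc n))

  module _ (W : NonBacktrackingWalk) where
    open NonBacktrackingWalk W

    closedWalk-length≥3 : ∀ ℓ a → vertex a ≡ vertex (a + suc ℓ) → 3 ≤ suc ℓ
    closedWalk-length≥3 0 a closed =
      ⊥-elim (adj⇒≢ (adjacent a) (trans closed (cong vertex (+-comm a 1))))
    closedWalk-length≥3 1 a closed =
      ⊥-elim (nonBacktracking a (trans closed (cong vertex (+-comm a 2))))
    closedWalk-length≥3 (suc (suc ℓ)) a closed = s≤s (s≤s (s≤s z≤n))

    simpleClosedWalk⇒cycle : ∀ ℓ a → (∀ i j → vertex (a + toℕ i) ≡ vertex (a + toℕ j) → i ≡ j) →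
      vertex a ≡ vertex (a + suc ℓ) → CycleWithin (suc ℓ)
    simpleClosedWalk⇒cycle ℓ a injective closed =
      ℓ , f , closedWalk-length≥3 ℓ a closed , ≤-refl , injective , edges , last
      where
      f : Fin (suc ℓ) → Vtx s
      f i = vertex (a + toℕ i)
      edges : ∀ (i : Fin ℓ) → adj (f (inject₁ i)) (f (suc i)) ≡ true
      edges i rewrite toℕ-inject₁ i | +-suc a (toℕ i) = adjacent (a + toℕ i)
      last : adj (f (fromℕ ℓ)) (f zero) ≡ true
      last rewrite toℕ-fromℕ ℓ | +-identityʳ a | closed | +-suc a ℓ = adjacent (a + ℓ)

    -- A repeated vertex inside a closed walk that is not simple cuts off a shorter closed walk.
    closedWalk⇒cycle : ∀ ℓ a → vertex a ≡ vertex (a + suc ℓ) → CycleWithin (suc ℓ)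
    closedWalk⇒cycle = <-rec _ step
      where
      step : ∀ ℓ → (∀ {o} → o < ℓ → ∀ a → vertex a ≡ vertex (a + suc o) → CycleWithin (suc o)) →
             ∀ a → vertex a ≡ vertex (a + suc ℓ) → CycleWithin (suc ℓ)
      step ℓ shorter a closed with collision-or-injective _≟ᵛ_ (λ (i : Fin (suc ℓ)) → vertex (a + toℕ i))
      ... | inj₂ injective = simpleClosedWalk⇒cycle ℓ a injective closed
      ... | inj₁ (i , j , i<j , repeat) with m≤n⇒∃[o]m+o≡n i<j
      ...   | o , i+1+o≡j = CycleWithin-mono (<⇒≤ (s≤s o<ℓ)) (shorter o<ℓ (a + toℕ i) closed′)
        where
        o<ℓ : o < ℓ
        o<ℓ = ≤-trans (s≤s (m≤n+m o (toℕ i))) (≤-trans (≤-reflexive i+1+o≡j) (toℕ≤pred[n] j))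
        closed′ : vertex (a + toℕ i) ≡ vertex (a + toℕ i + suc o)
        closed′ rewrite +-assoc a (toℕ i) (suc o) | +-suc (toℕ i) o | i+1+o≡j = repeat

    repeat⇒cycle : ∀ {a b} → a < b → vertex a ≡ vertex b → CycleWithin (b ∸ a)
    repeat⇒cycle {a} a<b repeat with m≤n⇒∃[o]m+o≡n a<b
    ... | o , refl rewrite sym (+-suc a o) | m+n∸m≡n a (suc o) = closedWalk⇒cycle o a repeat

alternate : ℕ → Bool
alternate zero    = false
alternate (suc k) = not (alternate k)

module GreedyColouring {s} (Conflict : Fin s → Bool → Fin s → Set)
  (conflict? : ∀ u c w → Dec (Conflict u c w))
  (conflict-sym : ∀ {u c w} → Conflict u c w → Conflict w c u) where

  AlternatingChain : Set
  AlternatingChain = ∃ λ (v : ℕ → Fin s) → ∀ k → Conflict (v k) (alternate k) (v (suc k))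

  ConflictIn : Subset s → Fin s → Bool → Set
  ConflictIn R u c = ∃ λ w → w ∈ R × Conflict u c w

  conflictIn? : ∀ R u c → Dec (ConflictIn R u c)
  conflictIn? R u c = any? λ w → (w ∈? R) ×-dec conflict? u c w

  Stuck : Subset s → Set
  Stuck R = ∀ {u} → u ∈ R → ∀ c → ConflictIn R u c

  stuck⇒chain : ∀ {R u} → Stuck R → u ∈ R → AlternatingChain
  stuck⇒chain {R} stuck u∈R = proj₁ ∘ walk , λ k → proj₂ (proj₂ (stuck (proj₂ (walk k)) (alternate k)))
    where
    walk : ℕ → ∃ (_∈ R)
    walk zero    = _ , u∈R
    walk (suc k) = let w , w∈R , _ = stuck (proj₂ (walk k)) (alternate k) in w , w∈R

  freeVertex : ∀ R → ¬ Stuck R → ∃₂ λ u c → u ∈ R × ¬ ConflictIn R u c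
  freeVertex R notStuck
    with any? (λ u → (u ∈? R) ×-dec (¬? (conflictIn? R u false) ⊎-dec ¬? (conflictIn? R u true)))
  ... | yes (u , u∈R , inj₁ free) = u , false , u∈R , free
  ... | yes (u , u∈R , inj₂ free) = u , true  , u∈R , free
  ... | no none = ⊥-elim (notStuck stuck)
    where
    stuck : Stuck R
    stuck {u} u∈R false = decidable-stable (conflictIn? R u false) λ free → none (u , u∈R , inj₁ free)
    stuck {u} u∈R true  = decidable-stable (conflictIn? R u true)  λ free → none (u , u∈R , inj₂ free)

  ProperOn : Subset s → (Fin s → Bool) → Set
  ProperOn R b = ∀ {u c w} → u ∈ R → w ∈ R → Conflict u c w → b u ≡ c → b w ≢ c

  Proper : (Fin s → Bool) → Set
  Proper b = ∀ {u c w} → Conflict u c w → b u ≡ c → b w ≢ c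

  private
    recoloured : ∀ (b : Fin s → Bool) u {c c′} → updateAt b u (const c) u ≡ c′ → c′ ≡ c
    recoloured b u = sym ∘ trans (sym (updateAt-updates u b))

  properOn-extend : ∀ {R u c b} → u ∈ R → ¬ ConflictIn R u c → ProperOn (R - u) b →
    ProperOn R (updateAt b u (const c))
  properOn-extend {R} {u} {c} {b} u∈R free proper {u′} {c′} {w} u′∈R w∈R conflict bu′ bw
    with u′ ≟ u | w ≟ u
  ... | yes refl | _ = free (w , w∈R , subst (λ d → Conflict u d w) (recoloured b u bu′) conflict)
  ... | no _ | yes refl =
    free (u′ , u′∈R , subst (λ d → Conflict u d u′) (recoloured b u bw) (conflict-sym conflict))
  ... | no u′≢u | no w≢u =
    proper (x∈p∧x≢y⇒x∈p-y u′∈R u′≢u) (x∈p∧x≢y⇒x∈p-y w∈R w≢u) conflict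
      (trans (sym (updateAt-minimal u′ u b u′≢u)) bu′) (trans (sym (updateAt-minimal w u b w≢u)) bw)

  properOn : ¬ AlternatingChain → ∀ R → ∃ (ProperOn R)
  properOn noChain R = go R (⊂-wellFounded R)
    where
    go : ∀ R → Acc _⊂_ R → ∃ (ProperOn R)
    go R (acc smaller) with nonempty? R
    ... | no empty = const false , λ u∈R → ⊥-elim (empty (_ , u∈R))
    ... | yes (_ , u₀∈R) with freeVertex R (noChain ∘ flip stuck⇒chain u₀∈R)
    ... | u , c , u∈R , free with go (R - u) (smaller (x∈p⇒p-x⊂p u∈R))
    ... | b , proper = updateAt b u (const c) , properOn-extend u∈R free proper

  properColouring : ¬ AlternatingChain → ∃ Proper
  properColouring noChain with properOn noChain ⊤
  ... | b , properOn⊤ = b , properOn⊤ ∈⊤ ∈⊤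

rank : ∀ {n} {p : Subset n} {x} → x ∈ p → Fin ∣ p ∣
rank here = zero
rank {p = true  ∷ _} (there x∈p) = suc (rank x∈p)
rank {p = false ∷ _} (there x∈p) = rank x∈p

rank-injective : ∀ {n} {p : Subset n} {x y} (x∈p : x ∈ p) (y∈p : y ∈ p) → rank x∈p ≡ rank y∈p → x ≡ y
rank-injective here here _ = refl
rank-injective {p = true  ∷ _} (there x∈p) (there y∈p) eq =
  cong suc (rank-injective x∈p y∈p (suc-injective eq))
rank-injective {p = false ∷ _} (there x∈p) (there y∈p) eq = cong suc (rank-injective x∈p y∈p eq)
rank-injective {p = true ∷ _} here (there _) ()
rank-injective {p = true ∷ _} (there _) here ()

tag : ∀ {A : Set} → Bool → A → A ⊎ A
tag false = inj₁
tag true  = inj₂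

tag-injective : ∀ {A : Set} c c′ {a a′ : A} → tag c a ≡ tag c′ a′ → c ≡ c′ × a ≡ a′
tag-injective false false refl = refl , refl
tag-injective true  true  refl = refl , refl
tag-injective false true  ()
tag-injective true  false ()

join-injective : ∀ m n {i j : Fin m ⊎ Fin n} → join m n i ≡ join m n j → i ≡ j
join-injective m n {i} {j} eq = begin
  i                      ≡⟨ splitAt-join m n i ⟨
  splitAt m (join m n i) ≡⟨ cong (splitAt m) eq ⟩
  splitAt m (join m n j) ≡⟨ splitAt-join m n j ⟩
  j                      ∎
  where open ≡-Reasoning

n+n+[n+n]≡4*n : ∀ n → (n + n) + (n + n) ≡ 4 * n
n+n+[n+n]≡4*n = solve-∀

module _ {m s} (Q : QueryGraph m s) (S : Subset m) where
  open QueryGraph Q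
  open Graph graph using (adj; adj-sym)

  index : Bool → Fin m → Fin s
  index false = i₀
  index true  = i₁

  side : Bool → Fin s → Vtx s
  side false = vA₀
  side true  = vA₁

  port : Bool → Fin m → Vtx s
  port c x = side c (index c x)

  port-edge : ∀ c x → adj (vA (i x)) (port c x) ≡ true
  port-edge false = edge₀
  port-edge true  = edge₁

  shared-port-edge : ∀ c {x y} → index c x ≡ index c y → adj (vA (i y)) (port c x) ≡ true
  shared-port-edge c {x} {y} same =
    subst (λ p → adj (vA (i y)) (side c p) ≡ true) (sym same) (port-edge c y)

  opposite-ports : ∀ c x y → port c x ≢ port (not c) y
  opposite-ports false _ _ ()
  opposite-ports true  _ _ ()

  shared-index⇒distinct-cells : ∀ c {x y} → x ≢ y → index c x ≡ index c y → i x ≢ i y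
  shared-index⇒distinct-cells false x≢y same same′ = label₀-inj _ _ x≢y (cong₂ _,_ same′ same)
  shared-index⇒distinct-cells true  x≢y same same′ = label₁-inj _ _ x≢y (cong₂ _,_ same′ same)

  Clash : Fin s → Bool → Fin s → Set
  Clash u c w = ∃₂ λ x y → x ∈ S × y ∉ S × index c x ≡ index c y × i x ≡ u × i y ≡ w

  clash? : ∀ u c w → Dec (Clash u c w)
  clash? u c w = any? λ x → any? λ y →
    (x ∈? S) ×-dec ¬? (y ∈? S) ×-dec (index c x ≟ index c y) ×-dec (i x ≟ u) ×-dec (i y ≟ w)

  Conflict : Fin s → Bool → Fin s → Set
  Conflict u c w = Clash u c w ⊎ Clash w c u

  open GreedyColouring Conflict (λ u c w → clash? u c w ⊎-dec clash? w c u) swap public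

  record Detour (u : Fin s) (c : Bool) (w : Fin s) : Set where
    field
      label   : Fin m
      member  : label ∈ S
      enter   : adj (vA u) (port c label) ≡ true
      leave   : adj (port c label) (vA w) ≡ true
      u≢w     : u ≢ w

  conflict⇒detour : ∀ {u c w} → Conflict u c w → Detour u c w
  conflict⇒detour {c = c} (inj₁ (x , y , x∈S , y∉S , same , refl , refl)) = record
    { label  = x
    ; member = x∈S
    ; enter  = port-edge c x
    ; leave  = trans (adj-sym _ _) (shared-port-edge c same)
    ; u≢w    = shared-index⇒distinct-cells c (λ { refl → y∉S x∈S }) same
    }
  conflict⇒detour {c = c} (inj₂ (x , y , x∈S , y∉S , same , refl , refl)) = record
    { label  = x
    ; member = x∈S
    ; enter  = shared-port-edge c same
    ; leave  = trans (adj-sym _ _) (port-edge c x)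
    ; u≢w    = ≢-sym (shared-index⇒distinct-cells c (λ { refl → y∉S x∈S }) same)
    }

  -- The walk hub 0, A[v 1], hub 1, A[v 2], …, where hub k is the middle vertex of the k-th conflict.
  module ChainWalk (chain : AlternatingChain) where
    v : ℕ → Fin s
    v = proj₁ chain

    detour : ∀ k → Detour (v k) (alternate k) (v (suc k))
    detour k = conflict⇒detour (proj₂ chain k)

    open module Detourₖ k = Detour (detour k)

    hub : ℕ → Vtx s
    hub k = port (alternate k) (label k)

    walk : NonBacktrackingWalk graph
    walk = record
      { vertex          = interleave hub (vA ∘ v ∘ suc)
      ; adjacent        = interleave-step (λ p q → adj p q ≡ true) leave (enter ∘ suc)
      ; nonBacktracking = interleave-step₂ _≢_ (λ k → opposite-ports (alternate k) _ _)
                                               (λ k → u≢w (suc k) ∘ vA-injective)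
      }

    code : ℕ → Fin (∣ S ∣ + ∣ S ∣)
    code k = join ∣ S ∣ ∣ S ∣ (tag (alternate k) (rank (member k)))

    sameCode⇒sameHub : ∀ k k′ → code k ≡ code k′ → hub k ≡ hub k′
    sameCode⇒sameHub k k′ same
      with tag-injective (alternate k) (alternate k′) (join-injective ∣ S ∣ ∣ S ∣ same)
    ... | sameColour , sameRank = cong₂ port sameColour (rank-injective (member k) (member k′) sameRank)

    -- 2|S| + 1 hubs carry only 2|S| codes.
    shortCycle : CycleWithin graph (4 * ∣ S ∣)
    shortCycle with pigeonhole (n<1+n (∣ S ∣ + ∣ S ∣)) (code ∘ toℕ)
    ... | k , k′ , k<k′ , same =
      CycleWithin-mono graph bound
        (repeat⇒cycle graph walk {toℕ k + toℕ k} (+-mono-< k<k′ k<k′) repeat)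
      where
      open NonBacktrackingWalk walk using (vertex)
      repeat : vertex (toℕ k + toℕ k) ≡ vertex (toℕ k′ + toℕ k′)
      repeat = trans (interleave-even hub _ (toℕ k))
                 (trans (sameCode⇒sameHub (toℕ k) (toℕ k′) same) (sym (interleave-even hub _ (toℕ k′))))
      k′≤ : toℕ k′ ≤ ∣ S ∣ + ∣ S ∣
      k′≤ = toℕ≤pred[n] k′
      bound : toℕ k′ + toℕ k′ ∸ (toℕ k + toℕ k) ≤ 4 * ∣ S ∣
      bound = ≤-trans (m∸n≤m (toℕ k′ + toℕ k′) (toℕ k + toℕ k))
                (≤-trans (+-mono-≤ k′≤ k′≤) (≤-reflexive (n+n+[n+n]≡4*n ∣ S ∣)))

  noAlternatingChain : GirthGreaterThan graph (4 * ∣ S ∣) → ¬ AlternatingChain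
  noAlternatingChain girth = girth⇒¬CycleWithin graph girth ∘ ChainWalk.shortCycle

  proper⇒satisfiable : ∀ {b} → Proper b → Satisfiable Q S
  proper⇒satisfiable {b} proper = b , cell false , cell true , correct
    where
    cell? : ∀ c p → Dec (∃ λ x → x ∈ S × b (i x) ≡ c × index c x ≡ p)
    cell? c p = any? λ x → (x ∈? S) ×-dec (b (i x) Bool.≟ c) ×-dec (index c x ≟ p)

    cell : Bool → Fin s → Bool
    cell c p = does (cell? c p)

    cell-correct : ∀ x c → b (i x) ≡ c → cell c (index c x) ≡ lookup S x
    cell-correct x c bx with lookup S x in Sx | cell? c (index c x)
    ... | true  | yes _   = refl
    ... | true  | no none = ⊥-elim (none (x , lookup⇒[]= x S Sx , bx , refl))
    ... | false | no _    = refl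
    ... | false | yes (x′ , x′∈S , bx′ , same) =
      ⊥-elim (proper (inj₁ (x′ , x , x′∈S , x∉S , same , refl , refl)) bx′ bx)
      where
      x∉S : x ∉ S
      x∉S x∈S = contradiction (trans (sym ([]=⇒lookup x∈S)) Sx) λ ()

    correct : ∀ x → answer Q b (cell false) (cell true) x ≡ lookup S x
    correct x with b (i x) in bx
    ... | false = cell-correct x false bx
    ... | true  = cell-correct x true  bx

lemma1 : ∀ {m s} (Q : QueryGraph m s) (S : Subset m) →
    GirthGreaterThan (QueryGraph.graph Q) (4 * ∣ S ∣) → Satisfiable Q S
lemma1 Q S girth =
  proper⇒satisfiable Q S (proj₂ (properColouring Q S (noAlternatingChain Q S girth)))
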